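{- Define integers $A'(n)$, $n\ge1$, by \[ \sum_{n=1}^\infty A'(n) q^n := \sum_{n=1}^\infty q^{n}(q^{n+1};q)_\infty^3 (q^{n};q)_{n}. \] Then \[ \sum_{n=1}^\infty q^{n}(q^{n+1};q)_\infty^3 (q^{n};q)_{n} = \sum_{n=1}^\infty (-1)^{n+1} n\, q^{\frac{n(n+1)}{2}}. \]
   Context: Here $q$ is a complex number with $|q|<1$ (equivalently, identities of formal power series in $q$). Notation: $(a;q)_0=1$, $(a;q)_n=\prod_{j=0}^{n-1}(1-aq^j)$, $(a;q)_\infty=\prod_{j=0}^{\infty}(1-aq^j)$, and $(a;q)_\infty^k$ denotes the $k$-th power of $(a;q)_\infty$. -}

module Defs where

open import Data.Nat as ℕ using (ℕ; zero; suc; _∸_)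
open import Data.Nat.DivMod using (_/_)
open import Data.Integer as ℤ using (ℤ; +_; -_)
open import Data.Bool using (if_then_else_)
open import Relation.Nullary using (does)

-- Formal power series in q with integer coefficients: n ↦ coefficient of q^n.
FPS : Set
FPS = ℕ → ℤ

sumTo : ℕ → (ℕ → ℤ) → ℤ
sumTo zero    f = f 0
sumTo (suc n) f = sumTo n f ℤ.+ f (suc n)

sum1To : ℕ → (ℕ → ℤ) → ℤ
sum1To zero    f = + 0
sum1To (suc n) f = sum1To n f ℤ.+ f (suc n)

_⊕_ : FPS → FPS → FPS
(f ⊕ g) n = f n ℤ.+ g n

_⊖ₛ_ : FPS → FPS → FPS
(f ⊖ₛ g) n = f n ℤ.- g n

_⊛_ : FPS → FPS → FPS
(f ⊛ g) n = sumTo n (λ k → f k ℤ.* g (n ∸ k))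

infixl 7 _⊛_
infixl 6 _⊕_ _⊖ₛ_

_·ₛ_ : ℤ → FPS → FPS
(c ·ₛ f) n = c ℤ.* f n

qpow : ℕ → FPS
qpow m n = if does (m ℕ.≟ n) then + 1 else + 0

one : FPS
one = qpow 0

cube : FPS → FPS
cube f = f ⊛ f ⊛ f

finProd : (ℕ → FPS) → ℕ → FPS
finProd f zero    = one
finProd f (suc M) = finProd f M ⊛ f M

qPoch : ℕ → ℕ → FPS
qPoch a n = finProd (λ j → one ⊖ₛ qpow (a ℕ.+ j)) n

-- (q^a;q)_∞ = ∏_{j≥0} (1 - q^{a+j}) as a formal power series:
-- the factors with j > N are 1 + O(q^{N+1}), so the coefficient of q^N
-- equals that of the finite product over j ≤ N.
qPochInf : ℕ → FPS
qPochInf a N = qPoch a (suc N) N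

-- Σ_{n≥1} t n  for a family with t n = O(q^n): the coefficient of q^N
-- only receives contributions from n ≤ N.
infSum1 : (ℕ → FPS) → FPS
infSum1 t N = sum1To N (λ n → t n N)

lhsTerm : ℕ → FPS
lhsTerm n = qpow n ⊛ cube (qPochInf (suc n)) ⊛ qPoch n n

rhsTerm : ℕ → FPS
rhsTerm n = ((- (+ 1)) ℤ.^ (suc n) ℤ.* (+ n)) ·ₛ qpow ((n ℕ.* suc n) / 2)

A′ : ℕ → ℤ
A′ = infSum1 lhsTerm

-- Compare both sides with the polynomials (M ≥ 0)
--   L_M = Σ_{n=1}^{M} q^n (q^{n+1};q)_{M-n}^3 (q^n;q)_n,
--   R_M = Σ_{k=1}^{M} k d_M(k),   d_M(k) = (-1)^{k+1} q^{k(k+1)/2} (q^{M+1-k};q)_k (q^{M+k+2};q)_{M-k}.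
-- L_M has the coefficient of q^M of the left side, because (q^{n+1};q)_∞ ≡ (q^{n+1};q)_{M-n}
-- mod q^{M+1}; R_M has that of the right side, because both Pochhammer factors of d_M(k) are
-- ≡ 1 mod q^{M-k+1} and k(k+1)/2 ≥ k. With Q = q^{M+1} both sequences start at 0 and satisfy
--   X_{M+1} = (1 - Q)^3 X_M + Q (Q;q)_{M+1}. For R_M it comes from the three-term recurrence
--   d_{M+1}(k) = (1 - Q) ((1 + Q^2) d_M(k) - Q (d_M(k-1) + d_M(k+1)))   (1 ≤ k ≤ M+1):
-- summing k d_{M+1}(k) by parts, with d_M(k) = 0 for k > M, leaves (1 - Q)^3 R_M - Q (1 - Q) d_M(0),
-- and -(1 - Q) d_M(0) = (Q;q)_{M+1}. Hence L_M = R_M, a polynomial identity that holds for q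
-- in any commutative ring.

module Submission where

open import Defs
open import Algebra.Bundles using (CommutativeRing)
import Algebra.Construct.Pointwise as Pointwise
import Algebra.Solver.Ring.AlmostCommutativeRing as ACR
open import Data.Bool.Base using (true; false)
open import Data.Empty using (⊥-elim)
open import Data.Integer as ℤ using (ℤ; +_; -[1+_]; _⊖_; -1ℤ)
import Data.Integer.Properties as ℤP
open import Data.Integer.Tactic.RingSolver as ℤ-Tactic using ()
open import Data.Maybe.Base using (Maybe; just; nothing)
open import Data.Nat as ℕ using (ℕ; zero; suc; _∸_; pred; _≤_; _<_; z≤n; s≤s)
open import Data.Nat.DivMod using (_/_; m*n/n≡m)
import Data.Nat.Properties as ℕP
open import Data.Nat.Tactic.RingSolver as ℕ-Tactic using ()
open import Data.Product.Base using (_,_)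
open import Data.Sum.Base using (inj₁; inj₂)
open import Relation.Nullary.Decidable using (yes; no)
open import Relation.Binary.PropositionalEquality as ≡ using (_≡_; module ≡-Reasoning)

module ℤ-Solver {c ℓ} (R : CommutativeRing c ℓ) where

  open CommutativeRing R
  open import Algebra.Properties.Ring ring using (-0#≈0#; -‿involutive; -‿distribˡ-*; -‿+-comm)
  open import Algebra.Properties.Semiring.Mult.TCOptimised semiring using (_×_; 1+×; ×-homo-+)
  open import Algebra.Properties.CommutativeSemigroup +-commutativeSemigroup using (interchange)
  open import Relation.Binary.Reasoning.Setoid setoid

  -- The optimised _×_ makes ι (+ 0) and ι (+ 1) reduce to 0# and 1#, so the solver's
  -- integer constants are definitionally the ring's own.
  ι : ℤ → Carrier
  ι (+ n)    = n × 1#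
  ι -[1+ n ] = - (suc n × 1#)

  ι-suc : ∀ n → ι (+ suc n) ≈ 1# + ι (+ n)
  ι-suc n = 1+× n 1#

  ι-neg : ∀ i → ι (ℤ.- i) ≈ - ι i
  ι-neg (+ zero)  = sym -0#≈0#
  ι-neg (+ suc n) = refl
  ι-neg -[1+ n ]  = sym (-‿involutive _)

  ι-⊖ : ∀ m n → ι (m ⊖ n) ≈ ι (+ m) - ι (+ n)
  ι-⊖ zero    zero    = sym (-‿inverseʳ 0#)
  ι-⊖ (suc m) zero    = sym (trans (+-congˡ -0#≈0#) (+-identityʳ _))
  ι-⊖ zero    (suc n) = sym (+-identityˡ _)
  ι-⊖ (suc m) (suc n) = begin
    ι (suc m ⊖ suc n)                  ≡⟨ ≡.cong ι (ℤP.[1+m]⊖[1+n]≡m⊖n m n) ⟩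
    ι (m ⊖ n)                          ≈⟨ ι-⊖ m n ⟩
    ι (+ m) - ι (+ n)                  ≈⟨ +-identityˡ _ ⟨
    0# + (ι (+ m) - ι (+ n))           ≈⟨ +-congʳ (-‿inverseʳ 1#) ⟨
    (1# - 1#) + (ι (+ m) - ι (+ n))    ≈⟨ interchange 1# (- 1#) (ι (+ m)) (- ι (+ n)) ⟩
    (1# + ι (+ m)) + (- 1# - ι (+ n))  ≈⟨ +-cong (ι-suc m) (trans (-‿cong (ι-suc n)) (sym (-‿+-comm 1# (ι (+ n))))) ⟨
    ι (+ suc m) - ι (+ suc n)          ∎

  ι-+ : ∀ i j → ι (i ℤ.+ j) ≈ ι i + ι j
  ι-+ (+ m)    (+ n)    = ×-homo-+ 1# m n
  ι-+ (+ m)    -[1+ n ] = ι-⊖ m (suc n)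
  ι-+ -[1+ m ] (+ n)    = trans (ι-⊖ n (suc m)) (+-comm _ _)
  ι-+ -[1+ m ] -[1+ n ] = begin
    - (suc (suc (m ℕ.+ n)) × 1#)     ≡⟨ ≡.cong (λ k → - (k × 1#)) (ℕP.+-suc (suc m) n) ⟨
    - ((suc m ℕ.+ suc n) × 1#)       ≈⟨ -‿cong (×-homo-+ 1# (suc m) (suc n)) ⟩
    - (suc m × 1# + suc n × 1#)      ≈⟨ -‿+-comm _ _ ⟨
    - (suc m × 1#) + - (suc n × 1#)  ∎

  ι-pos-* : ∀ m j → ι (+ m ℤ.* j) ≈ ι (+ m) * ι j
  ι-pos-* zero    j = sym (zeroˡ (ι j))
  ι-pos-* (suc m) j = begin
    ι (+ suc m ℤ.* j)           ≡⟨ ≡.cong ι (ℤP.suc-* (+ m) j) ⟩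
    ι (j ℤ.+ + m ℤ.* j)         ≈⟨ ι-+ j (+ m ℤ.* j) ⟩
    ι j + ι (+ m ℤ.* j)         ≈⟨ +-cong (*-identityˡ (ι j)) (sym (ι-pos-* m j)) ⟨
    1# * ι j + ι (+ m) * ι j    ≈⟨ distribʳ (ι j) 1# (ι (+ m)) ⟨
    (1# + ι (+ m)) * ι j        ≈⟨ *-congʳ (ι-suc m) ⟨
    ι (+ suc m) * ι j           ∎

  ι-* : ∀ i j → ι (i ℤ.* j) ≈ ι i * ι j
  ι-* (+ m)    j = ι-pos-* m j
  ι-* -[1+ m ] j = begin
    ι (-[1+ m ] ℤ.* j)          ≡⟨ ≡.cong ι (ℤP.neg-distribˡ-* (+ suc m) j) ⟨
    ι (ℤ.- (+ suc m ℤ.* j))     ≈⟨ ι-neg (+ suc m ℤ.* j) ⟩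
    - ι (+ suc m ℤ.* j)         ≈⟨ -‿cong (ι-pos-* (suc m) j) ⟩
    - (ι (+ suc m) * ι j)       ≈⟨ -‿distribˡ-* (ι (+ suc m)) (ι j) ⟩
    ι -[1+ m ] * ι j            ∎

  ι-homomorphism : ℤ.+-*-rawRing ACR.-Raw-AlmostCommutative⟶ ACR.fromCommutativeRing R
  ι-homomorphism = record
    { ⟦_⟧ = ι ; +-homo = ι-+ ; *-homo = ι-* ; -‿homo = ι-neg ; 0-homo = refl ; 1-homo = refl }

  ι-≟ : ∀ i j → Maybe (ι i ≈ ι j)
  ι-≟ i j with i ℤ.≟ j
  ... | yes ≡.refl = just refl
  ... | no _       = nothing

  open import Algebra.Solver.Ring ℤ.+-*-rawRing (ACR.fromCommutativeRing R) ι-homomorphism ι-≟ public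

+-shuffle : ∀ c m d n → c ℕ.+ m ℕ.+ (d ℕ.+ n) ≡ c ℕ.+ d ℕ.+ (n ℕ.+ m)
+-shuffle = ℕ-Tactic.solve-∀

∸-cancel : ∀ c n m → c ℕ.+ n ℕ.+ m ∸ n ≡ c ℕ.+ m
∸-cancel c n m = ≡.trans (≡.cong (_∸ n) (swap c n m)) (ℕP.m+n∸m≡n n (c ℕ.+ m))
  where
  swap : ∀ c n m → c ℕ.+ n ℕ.+ m ≡ n ℕ.+ (c ℕ.+ m)
  swap = ℕ-Tactic.solve-∀

tri : ℕ → ℕ
tri zero    = 0
tri (suc k) = tri k ℕ.+ suc k

tri≥ : ∀ k → k ≤ tri k
tri≥ zero    = z≤n
tri≥ (suc k) = ℕP.m≤n+m (suc k) (tri k)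

tri*2 : ∀ k → tri k ℕ.* 2 ≡ k ℕ.* suc k
tri*2 zero    = ≡.refl
tri*2 (suc k) = begin
  (tri k ℕ.+ suc k) ℕ.* 2       ≡⟨ ℕP.*-distribʳ-+ 2 (tri k) (suc k) ⟩
  tri k ℕ.* 2 ℕ.+ suc k ℕ.* 2   ≡⟨ ≡.cong (ℕ._+ suc k ℕ.* 2) (tri*2 k) ⟩
  k ℕ.* suc k ℕ.+ suc k ℕ.* 2   ≡⟨ step k ⟩
  suc k ℕ.* suc (suc k)         ∎
  where
  open ≡-Reasoning
  step : ∀ k → k ℕ.* suc k ℕ.+ suc k ℕ.* 2 ≡ suc k ℕ.* suc (suc k)
  step = ℕ-Tactic.solve-∀

tri-div : ∀ k → (k ℕ.* suc k) / 2 ≡ tri k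
tri-div k = ≡.trans (≡.cong (_/ 2) (≡.sym (tri*2 k))) (m*n/n≡m (tri k) 2)

module FiniteIdentity {c ℓ} (R : CommutativeRing c ℓ) (q : CommutativeRing.Carrier R) where

  open CommutativeRing R
  open ℤ-Solver R using (solve; _:=_; _:+_; _:-_; _:*_; :-_; _:^_; con)
  open import Algebra.Properties.Semiring.Exp semiring using (_^_; ^-homo-*)
  open import Algebra.Properties.CommutativeSemigroup +-commutativeSemigroup using (interchange)
  open import Relation.Binary.Reasoning.Setoid setoid

  infix 10 _³
  _³ : Carrier → Carrier
  x ³ = x * x * x

  1-cong : ∀ {x y} → x ≈ y → 1# - x ≈ 1# - y
  1-cong x≈y = +-congˡ (-‿cong x≈y)

  -- k · 1# and (-1)^(k+1), by recursions the solver can see through.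
  weight : ℕ → Carrier
  weight zero    = 0#
  weight (suc k) = 1# + weight k

  sign : ℕ → Carrier
  sign zero    = - 1#
  sign (suc k) = - sign k

  ∑₁ : ℕ → (ℕ → Carrier) → Carrier
  ∑₁ zero    f = 0#
  ∑₁ (suc m) f = ∑₁ m f + f (suc m)

  ∑₁-cong : ∀ m {f g} → (∀ j → j < m → f (suc j) ≈ g (suc j)) → ∑₁ m f ≈ ∑₁ m g
  ∑₁-cong zero    f≈g = refl
  ∑₁-cong (suc m) f≈g = +-cong (∑₁-cong m (λ j j<m → f≈g j (ℕP.m<n⇒m<1+n j<m))) (f≈g m ℕP.≤-refl)

  ∑₁-+ : ∀ m f g → ∑₁ m (λ k → f k + g k) ≈ ∑₁ m f + ∑₁ m g
  ∑₁-+ zero    f g = sym (+-identityˡ 0#)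
  ∑₁-+ (suc m) f g = trans (+-congʳ (∑₁-+ m f g)) (interchange _ _ _ _)

  ∑₁-*ˡ : ∀ m a f → ∑₁ m (λ k → a * f k) ≈ a * ∑₁ m f
  ∑₁-*ˡ zero    a f = sym (zeroʳ a)
  ∑₁-*ˡ (suc m) a f = trans (+-congʳ (∑₁-*ˡ m a f)) (sym (distribˡ a _ _))

  ∑₁-neighbours : ∀ m (g : ℕ → Carrier) →
    ∑₁ m (λ k → weight k * (g (pred k) + g (suc k)))
      ≈ g 0 + weight 2 * ∑₁ m (λ k → weight k * g k) - weight (suc m) * g m + weight m * g (suc m)
  ∑₁-neighbours zero g =
    solve 2 (λ g₀ g₁ → let one = con (+ 1) ; nil = con (+ 0) in
      nil := g₀ :+ (one :+ (one :+ nil)) :* nil :- (one :+ nil) :* g₀ :+ nil :* g₁)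
      refl (g 0) (g 1)
  ∑₁-neighbours (suc m) g = begin
    ∑₁ m (λ k → weight k * (g (pred k) + g (suc k))) + weight (suc m) * (g m + g (2 ℕ.+ m))
      ≈⟨ +-congʳ (∑₁-neighbours m g) ⟩
    g 0 + weight 2 * W - weight (suc m) * g m + weight m * g (suc m) + weight (suc m) * (g m + g (2 ℕ.+ m))
      ≈⟨ solve 6 (λ g₀ W w gₘ g₁ g₂ → let one = con (+ 1) ; two = one :+ (one :+ con (+ 0)) ; w′ = one :+ w in
           g₀ :+ two :* W :- w′ :* gₘ :+ w :* g₁ :+ w′ :* (gₘ :+ g₂)
             := g₀ :+ two :* (W :+ w′ :* g₁) :- (one :+ w′) :* g₁ :+ w′ :* g₂)
           refl (g 0) W (weight m) (g m) (g (suc m)) (g (2 ℕ.+ m)) ⟩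
    g 0 + weight 2 * (W + weight (suc m) * g (suc m)) - weight (2 ℕ.+ m) * g (suc m) + weight (suc m) * g (2 ℕ.+ m)
      ∎
    where
    W : Carrier
    W = ∑₁ m (λ k → weight k * g k)

  poch : Carrier → ℕ → Carrier
  poch x zero    = 1#
  poch x (suc n) = poch x n * (1# - x * q ^ n)

  poch-first : ∀ x n → poch x (suc n) ≈ (1# - x) * poch (q * x) n
  poch-first x zero    =
    solve 1 (λ x → let one = con (+ 1) in one :* (one :- x :* one) := (one :- x) :* one) refl x
  poch-first x (suc n) = begin
    poch x (suc n) * (1# - x * (q * q ^ n))             ≈⟨ *-congʳ (poch-first x n) ⟩
    (1# - x) * poch (q * x) n * (1# - x * (q * q ^ n))  ≈⟨ solve 4 (λ x q qⁿ p → let one = con (+ 1) in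
                                                             (one :- x) :* p :* (one :- x :* (q :* qⁿ))
                                                               := (one :- x) :* (p :* (one :- q :* x :* qⁿ)))
                                                             refl x q (q ^ n) (poch (q * x) n) ⟩
    (1# - x) * (poch (q * x) n * (1# - q * x * q ^ n))  ∎

  poch-1# : ∀ n → poch 1# (suc n) ≈ 0#
  poch-1# n = begin
    poch 1# (suc n)              ≈⟨ poch-first 1# n ⟩
    (1# - 1#) * poch (q * 1#) n  ≈⟨ *-congʳ (-‿inverseʳ 1#) ⟩
    0# * poch (q * 1#) n         ≈⟨ zeroˡ _ ⟩
    0#                           ∎

  P : ℕ → ℕ → Carrier
  P M k = poch (q ^ (suc M ∸ k)) k * poch (q ^ (2 ℕ.+ M ℕ.+ k)) (M ∸ k)

  P-reindex : ∀ M k {e₁ e₂ n} → suc M ∸ k ≡ e₁ → 2 ℕ.+ M ℕ.+ k ≡ e₂ → M ∸ k ≡ n →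
              P M k ≈ poch (q ^ e₁) k * poch (q ^ e₂) n
  P-reindex M k ≡.refl ≡.refl ≡.refl = refl

  P-vanishes : ∀ M k → M < k → P M k ≈ 0#
  P-vanishes M (suc k) (s≤s M≤k) = begin
    P M (suc k)            ≈⟨ P-reindex M (suc k) (ℕP.m≤n⇒m∸n≡0 M≤k) ≡.refl ≡.refl ⟩
    poch 1# (suc k) * Z    ≈⟨ *-congʳ (poch-1# k) ⟩
    0# * Z                 ≈⟨ zeroˡ Z ⟩
    0#                     ∎
    where
    Z : Carrier
    Z = poch (q ^ (2 ℕ.+ M ℕ.+ suc k)) (M ∸ suc k)

  recurrenceRhs : (Q x Pₖ Pₖ₋₁ Pₖ₊₁ : Carrier) → Carrier
  recurrenceRhs Q x Pₖ Pₖ₋₁ Pₖ₊₁ = (1# - Q) * ((1# + Q * Q) * (x * Pₖ) + Q * Pₖ₋₁ + Q * (x * x * q) * Pₖ₊₁)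

  recurrenceRhs-cong : ∀ {Q Q′ x a a′ b b′ c c′} → Q ≈ Q′ → a ≈ a′ → b ≈ b′ → c ≈ c′ →
                       recurrenceRhs Q x a b c ≈ recurrenceRhs Q′ x a′ b′ c′
  recurrenceRhs-cong Q≈ a≈ b≈ c≈ =
    *-cong (1-cong Q≈)
           (+-cong (+-cong (*-cong (+-congˡ (*-cong Q≈ Q≈)) (*-congˡ a≈)) (*-cong Q≈ b≈)) (*-cong (*-congʳ Q≈) c≈))

  -- d-recurrence at k = suc j, divided by the common factor (-1)^j q^(tri j) of its terms.
  P-Recurrence : ℕ → ℕ → Set ℓ
  P-Recurrence M j =
    q ^ suc j * P (suc M) (suc j) ≈ recurrenceRhs (q ^ suc M) (q ^ suc j) (P M (suc j)) (P M j) (P M (2 ℕ.+ j))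

  -- Cases k = M + 1, k = M and k < M (with k = suc j): truncated subtraction makes P M (k + 1)
  -- and the second factor of P M k degenerate in the first two.
  P-recurrence-top : ∀ j → P-Recurrence j j
  P-recurrence-top j = begin
    x * P (suc j) (suc j)
      ≈⟨ *-congˡ (P-reindex (suc j) (suc j) (ℕP.m+n∸n≡m 1 j) ≡.refl (ℕP.n∸n≡0 j)) ⟩
    x * (A * (1# - q ^ 1 * u) * 1#)
      ≈⟨ solve 3 (λ q u A → let x = q :* u ; one = con (+ 1) ; nil = con (+ 0) in
           x :* (A :* (one :- q :^ 1 :* u) :* one)
             := (one :- x) :* ((one :+ x :* x) :* (x :* nil) :+ x :* (A :* one) :+ x :* (x :* x :* q) :* nil))
           refl q u A ⟩
    recurrenceRhs x x 0# (A * 1#) 0#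
      ≈⟨ recurrenceRhs-cong refl (P-vanishes j (suc j) ℕP.≤-refl) Pⱼ≈ (P-vanishes j (2 ℕ.+ j) (ℕP.n≤1+n (suc j))) ⟨
    recurrenceRhs x x (P j (suc j)) (P j j) (P j (2 ℕ.+ j)) ∎
    where
    x u A : Carrier
    x = q ^ suc j
    u = q ^ j
    A = poch (q ^ 1) j
    Pⱼ≈ : P j j ≈ A * 1#
    Pⱼ≈ = P-reindex j j (ℕP.m+n∸n≡m 1 j) ≡.refl (ℕP.n∸n≡0 j)

  P-recurrence-diag : ∀ j → P-Recurrence (suc j) j
  P-recurrence-diag j = begin
    x * P (2 ℕ.+ j) (suc j)
      ≈⟨ *-congˡ P₊≈ ⟩
    x * (A * (1# - q ^ 2 * u) * (1# * (1# - q ^ 5 * (u * u) * 1#)))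
      ≈⟨ solve 3 (λ q u A → let x = q :* u ; Q = q :* x ; one = con (+ 1) in
           x :* (A :* (one :- q :^ 2 :* u) :* (one :* (one :- q :^ 5 :* (u :* u) :* one)))
             := (one :- Q) :* ((one :+ Q :* Q) :* (x :* ((one :- q :^ 1) :* A :* one))
                               :+ Q :* (A :* (one :* (one :- q :^ 3 :* (u :* u) :* one)))
                               :+ Q :* (x :* x :* q) :* con (+ 0)))
           refl q u A ⟩
    recurrenceRhs Q x ((1# - q ^ 1) * A * 1#) (A * (1# * (1# - q ^ 3 * (u * u) * 1#))) 0#
      ≈⟨ recurrenceRhs-cong refl Pₖ≈ Pⱼ≈ (P-vanishes (suc j) (2 ℕ.+ j) ℕP.≤-refl) ⟨
    recurrenceRhs Q x (P (suc j) (suc j)) (P (suc j) j) (P (suc j) (2 ℕ.+ j)) ∎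
    where
    x Q u A : Carrier
    x = q ^ suc j
    Q = q ^ (2 ℕ.+ j)
    u = q ^ j
    A = poch (q ^ 2) j
    q^[c+2j] : ∀ c → q ^ (c ℕ.+ (j ℕ.+ j)) ≈ q ^ c * (u * u)
    q^[c+2j] c = trans (^-homo-* q c (j ℕ.+ j)) (*-congˡ (^-homo-* q j j))
    P₊≈ : P (2 ℕ.+ j) (suc j) ≈ A * (1# - q ^ 2 * u) * (1# * (1# - q ^ 5 * (u * u) * 1#))
    P₊≈ = trans (P-reindex (2 ℕ.+ j) (suc j) (ℕP.m+n∸n≡m 2 j) (+-shuffle 4 j 1 j) (ℕP.m+n∸n≡m 1 j))
                (*-congˡ (*-congˡ (1-cong (*-congʳ (q^[c+2j] 5)))))
    Pₖ≈ : P (suc j) (suc j) ≈ (1# - q ^ 1) * A * 1#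
    Pₖ≈ = trans (P-reindex (suc j) (suc j) (ℕP.m+n∸n≡m 1 j) ≡.refl (ℕP.n∸n≡0 j))
                (*-congʳ (poch-first (q ^ 1) j))
    Pⱼ≈ : P (suc j) j ≈ A * (1# * (1# - q ^ 3 * (u * u) * 1#))
    Pⱼ≈ = trans (P-reindex (suc j) j (ℕP.m+n∸n≡m 2 j) (+-shuffle 3 j 0 j) (ℕP.m+n∸n≡m 1 j))
                (*-congˡ (*-congˡ (1-cong (*-congʳ (q^[c+2j] 3)))))

  -- A and B are the Pochhammer factors shared by the four values of P; all other factors are
  -- polynomials in q, u = q ^ j and v = q ^ a.
  P-recurrence-interior : ∀ j a → P-Recurrence (2 ℕ.+ j ℕ.+ a) j
  P-recurrence-interior j a = begin
    x * P (suc M) (suc j)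
      ≈⟨ *-congˡ P₊≈ ⟩
    x * (A * (1# - q * y * u) * (B * (1# - q ^ 6 * w * v) * (1# - q ^ 6 * w * (q * v))))
      ≈⟨ solve 5 (λ q u v A B → let x = q :* u ; y = q :* (q :* v) ; w = u :* (u :* v)
                                    Q = q :* (q :* (q :* (u :* v))) ; one = con (+ 1) in
           x :* (A :* (one :- q :* y :* u) :* (B :* (one :- q :^ 6 :* w :* v) :* (one :- q :^ 6 :* w :* (q :* v))))
             := (one :- Q) :* ((one :+ Q :* Q) :* (x :* ((one :- y) :* A :* ((one :- q :^ 5 :* w) :* B)))
                               :+ Q :* (A :* ((one :- q :^ 4 :* w) :* ((one :- q :^ 5 :* w) :* B)))
                               :+ Q :* (x :* x :* q) :* ((one :- q :* v) :* ((one :- y) :* A) :* B)))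
           refl q u v A B ⟩
    recurrenceRhs Q x ((1# - y) * A * ((1# - q ^ 5 * w) * B)) (A * ((1# - q ^ 4 * w) * ((1# - q ^ 5 * w) * B)))
                      ((1# - q * v) * ((1# - y) * A) * B)
      ≈⟨ recurrenceRhs-cong Q≈ Pₖ≈ Pⱼ≈ Pₖ₊₁≈ ⟨
    recurrenceRhs (q ^ suc M) x (P M (suc j)) (P M j) (P M (2 ℕ.+ j)) ∎
    where
    M : ℕ
    M = 2 ℕ.+ j ℕ.+ a
    x u v y w Q A B : Carrier
    x = q ^ suc j
    u = q ^ j
    v = q ^ a
    y = q ^ (2 ℕ.+ a)
    w = u * (u * v)
    Q = q * (q * (q * (u * v)))
    A = poch (q ^ (3 ℕ.+ a)) j
    B = poch (q ^ (6 ℕ.+ (j ℕ.+ (j ℕ.+ a)))) a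
    Q≈ : q ^ suc M ≈ Q
    Q≈ = *-congˡ (*-congˡ (*-congˡ (^-homo-* q j a)))
    q^[c+2j+a] : ∀ c → q ^ (c ℕ.+ (j ℕ.+ (j ℕ.+ a))) ≈ q ^ c * w
    q^[c+2j+a] c = trans (^-homo-* q c _) (*-congˡ (trans (^-homo-* q j (j ℕ.+ a)) (*-congˡ (^-homo-* q j a))))
    P₊≈ : P (suc M) (suc j) ≈ A * (1# - q * y * u) * (B * (1# - q ^ 6 * w * v) * (1# - q ^ 6 * w * (q * v)))
    P₊≈ = trans (P-reindex (suc M) (suc j) (∸-cancel 3 j a) (+-shuffle 5 (j ℕ.+ a) 1 j) (∸-cancel 2 j a))
                (*-congˡ (*-cong (*-congˡ (1-cong (*-congʳ (q^[c+2j+a] 6)))) (1-cong (*-congʳ (q^[c+2j+a] 6)))))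
    Pₖ≈ : P M (suc j) ≈ (1# - y) * A * ((1# - q ^ 5 * w) * B)
    Pₖ≈ = trans (P-reindex M (suc j) (∸-cancel 2 j a) (+-shuffle 4 (j ℕ.+ a) 1 j) (∸-cancel 1 j a))
                (*-cong (poch-first _ j) (trans (poch-first _ a) (*-congʳ (1-cong (q^[c+2j+a] 5)))))
    Pⱼ≈ : P M j ≈ A * ((1# - q ^ 4 * w) * ((1# - q ^ 5 * w) * B))
    Pⱼ≈ = trans (P-reindex M j (∸-cancel 3 j a) (+-shuffle 4 (j ℕ.+ a) 0 j) (∸-cancel 2 j a))
                (*-congˡ (trans (poch-first _ (suc a))
                                (*-cong (1-cong (q^[c+2j+a] 4))
                                        (trans (poch-first _ a) (*-congʳ (1-cong (q^[c+2j+a] 5)))))))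
    Pₖ₊₁≈ : P M (2 ℕ.+ j) ≈ (1# - q * v) * ((1# - y) * A) * B
    Pₖ₊₁≈ = trans (P-reindex M (2 ℕ.+ j) (∸-cancel 1 j a) (+-shuffle 4 (j ℕ.+ a) 2 j) (∸-cancel 0 j a))
                  (*-congʳ (trans (poch-first _ (suc j)) (*-congˡ (poch-first _ j))))

  P-recurrence : ∀ M j → j ≤ M → P-Recurrence M j
  P-recurrence M j j≤M with ℕP.m≤n⇒m<n∨m≡n j≤M
  ... | inj₂ ≡.refl = P-recurrence-top j
  ... | inj₁ j<M with ℕP.m≤n⇒m<n∨m≡n j<M
  ...   | inj₂ ≡.refl = P-recurrence-diag j
  ...   | inj₁ 1+j<M with ℕP.m≤n⇒∃[o]m+o≡n 1+j<M
  ...     | a , ≡.refl = P-recurrence-interior j a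

  d : ℕ → ℕ → Carrier
  d M k = sign k * (q ^ tri k * P M k)

  d-vanishes : ∀ M k → M < k → d M k ≈ 0#
  d-vanishes M k M<k = trans (*-congˡ (trans (*-congˡ (P-vanishes M k M<k)) (zeroʳ _))) (zeroʳ _)

  d-zero : ∀ M → d M 0 ≈ - poch (q ^ (2 ℕ.+ M)) M
  d-zero M = trans (*-congˡ (*-congˡ (P-reindex M 0 ≡.refl (ℕP.+-identityʳ (2 ℕ.+ M)) ≡.refl)))
                   (solve 1 (λ Z → let one = con (+ 1) in :- one :* (one :* (one :* Z)) := :- Z)
                          refl (poch (q ^ (2 ℕ.+ M)) M))

  q^tri-suc : ∀ k → q ^ tri (suc k) ≈ q ^ tri k * q ^ suc k
  q^tri-suc k = ^-homo-* q (tri k) (suc k)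

  d-recurrence : ∀ M j → j ≤ M → let Q = q ^ suc M in
    d (suc M) (suc j) ≈ (1# - Q) * ((1# + Q * Q) * d M (suc j) - Q * (d M j + d M (2 ℕ.+ j)))
  d-recurrence M j j≤M = begin
    - s * (q ^ tri (suc j) * P (suc M) (suc j))  ≈⟨ *-congˡ (*-congʳ (q^tri-suc j)) ⟩
    - s * (t * x * P (suc M) (suc j))            ≈⟨ solve 4 (λ s t x p → :- s :* (t :* x :* p) := (:- s :* t) :* (x :* p))
                                                        refl s t x (P (suc M) (suc j)) ⟩
    (- s * t) * (x * P (suc M) (suc j))          ≈⟨ *-congˡ (P-recurrence M j j≤M) ⟩
    (- s * t) * recurrenceRhs Q x Pₖ Pⱼ Pₖ₊₁
      ≈⟨ solve 8 (λ s t x q Q Pₖ Pⱼ Pₖ₊₁ → let one = con (+ 1) in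
           (:- s :* t) :* ((one :- Q) :* ((one :+ Q :* Q) :* (x :* Pₖ) :+ Q :* Pⱼ :+ Q :* (x :* x :* q) :* Pₖ₊₁))
             := (one :- Q) :* ((one :+ Q :* Q) :* (:- s :* (t :* x :* Pₖ))
                               :- Q :* (s :* (t :* Pⱼ) :+ :- :- s :* (t :* x :* (q :* x) :* Pₖ₊₁))))
           refl s t x q Q Pₖ Pⱼ Pₖ₊₁ ⟩
    (1# - Q) * ((1# + Q * Q) * (- s * (t * x * Pₖ)) - Q * (s * (t * Pⱼ) + - - s * (t * x * (q * x) * Pₖ₊₁)))
      ≈⟨ *-congˡ (+-cong (*-congˡ (*-congˡ (*-congʳ (q^tri-suc j))))
                         (-‿cong (*-congˡ (+-congˡ (*-congˡ (*-congʳ (trans (q^tri-suc (suc j))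
                                                                              (*-congʳ (q^tri-suc j))))))))) ⟨
    (1# - Q) * ((1# + Q * Q) * d M (suc j) - Q * (d M j + d M (2 ℕ.+ j))) ∎
    where
    s t x Q Pₖ Pⱼ Pₖ₊₁ : Carrier
    s = sign j
    t = q ^ tri j
    x = q ^ suc j
    Q = q ^ suc M
    Pₖ = P M (suc j)
    Pⱼ = P M j
    Pₖ₊₁ = P M (2 ℕ.+ j)

  lhsSummand : ℕ → ℕ → Carrier
  lhsSummand M n = q ^ n * poch (q ^ suc n) (M ∸ n) ³ * poch (q ^ n) n

  lhsPoly : ℕ → Carrier
  lhsPoly M = ∑₁ M (lhsSummand M)

  lhsSummand-suc : ∀ M n → n ≤ M → lhsSummand (suc M) n ≈ (1# - q ^ suc M) ³ * lhsSummand M n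
  lhsSummand-suc M n n≤M = begin
    q ^ n * poch (q ^ suc n) (suc M ∸ n) ³ * E
      ≡⟨ ≡.cong (λ m → q ^ n * poch (q ^ suc n) m ³ * E) (ℕP.+-∸-assoc 1 n≤M) ⟩
    q ^ n * (C * (1# - q ^ suc n * q ^ (M ∸ n))) ³ * E
      ≈⟨ *-congʳ (*-congˡ (³-cong (*-congˡ (1-cong (sym (^-homo-* q (suc n) (M ∸ n))))))) ⟩
    q ^ n * (C * (1# - q ^ (suc n ℕ.+ (M ∸ n)))) ³ * E
      ≡⟨ ≡.cong (λ m → q ^ n * (C * (1# - q ^ suc m)) ³ * E) (ℕP.m+[n∸m]≡n n≤M) ⟩
    q ^ n * (C * (1# - Q)) ³ * E
      ≈⟨ solve 4 (λ qⁿ C Q E → let G = con (+ 1) :- Q ; F = C :* G in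
           qⁿ :* (F :* F :* F) :* E := (G :* G :* G) :* (qⁿ :* (C :* C :* C) :* E))
           refl (q ^ n) C Q E ⟩
    (1# - Q) ³ * (q ^ n * C ³ * E) ∎
    where
    C E Q : Carrier
    C = poch (q ^ suc n) (M ∸ n)
    E = poch (q ^ n) n
    Q = q ^ suc M
    ³-cong : ∀ {x y} → x ≈ y → x ³ ≈ y ³
    ³-cong x≈y = *-cong (*-cong x≈y x≈y) x≈y

  lhsPoly-suc : ∀ M → let Q = q ^ suc M in lhsPoly (suc M) ≈ (1# - Q) ³ * lhsPoly M + Q * poch Q (suc M)
  lhsPoly-suc M = begin
    ∑₁ M (lhsSummand (suc M)) + lhsSummand (suc M) (suc M)
      ≈⟨ +-cong (∑₁-cong M (λ j j<M → lhsSummand-suc M (suc j) j<M)) last ⟩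
    ∑₁ M (λ n → (1# - Q) ³ * lhsSummand M n) + Q * poch Q (suc M)
      ≈⟨ +-congʳ (∑₁-*ˡ M ((1# - Q) ³) (lhsSummand M)) ⟩
    (1# - Q) ³ * lhsPoly M + Q * poch Q (suc M) ∎
    where
    Q : Carrier
    Q = q ^ suc M
    last : lhsSummand (suc M) (suc M) ≈ Q * poch Q (suc M)
    last = begin
      Q * poch (q * Q) (M ∸ M) ³ * poch Q (suc M)
        ≡⟨ ≡.cong (λ m → Q * poch (q * Q) m ³ * poch Q (suc M)) (ℕP.n∸n≡0 M) ⟩
      Q * 1# ³ * poch Q (suc M)
        ≈⟨ solve 2 (λ Q E → let one = con (+ 1) in Q :* (one :* one :* one) :* E := Q :* E) refl Q (poch Q (suc M)) ⟩
      Q * poch Q (suc M) ∎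

  rhsSummand : ℕ → ℕ → Carrier
  rhsSummand M k = weight k * d M k

  rhsPoly : ℕ → Carrier
  rhsPoly M = ∑₁ M (rhsSummand M)

  rhsPoly-extend : ∀ M → ∑₁ (suc M) (rhsSummand M) ≈ rhsPoly M
  rhsPoly-extend M = trans (+-congˡ (trans (*-congˡ (d-vanishes M (suc M) ℕP.≤-refl)) (zeroʳ _))) (+-identityʳ _)

  d-neighbours : ∀ M → ∑₁ (suc M) (λ k → weight k * (d M (pred k) + d M (suc k))) ≈ d M 0 + weight 2 * rhsPoly M
  d-neighbours M = begin
    ∑₁ (suc M) (λ k → weight k * (d M (pred k) + d M (suc k)))
      ≈⟨ ∑₁-neighbours (suc M) (d M) ⟩
    d M 0 + weight 2 * ∑₁ (suc M) (rhsSummand M) - weight (2 ℕ.+ M) * d M (suc M) + weight (suc M) * d M (2 ℕ.+ M)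
      ≈⟨ +-cong (+-cong (+-congˡ (*-congˡ (rhsPoly-extend M))) (-‿cong (*-congˡ (d-vanishes M (suc M) ℕP.≤-refl))))
                (*-congˡ (d-vanishes M (2 ℕ.+ M) (ℕP.n≤1+n (suc M)))) ⟩
    d M 0 + weight 2 * rhsPoly M - weight (2 ℕ.+ M) * 0# + weight (suc M) * 0#
      ≈⟨ solve 4 (λ d₀ W w₂ w₁ → let one = con (+ 1) ; nil = con (+ 0) ; two = one :+ (one :+ nil) in
           d₀ :+ two :* W :- w₂ :* nil :+ w₁ :* nil := d₀ :+ two :* W)
           refl (d M 0) (rhsPoly M) (weight (2 ℕ.+ M)) (weight (suc M)) ⟩
    d M 0 + weight 2 * rhsPoly M ∎

  rhsPoly-suc : ∀ M → let Q = q ^ suc M in rhsPoly (suc M) ≈ (1# - Q) ³ * rhsPoly M + Q * poch Q (suc M)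
  rhsPoly-suc M = begin
    ∑₁ (suc M) (rhsSummand (suc M))
      ≈⟨ ∑₁-cong (suc M) (λ j j<1+M → summand-suc j (ℕP.≤-pred j<1+M)) ⟩
    ∑₁ (suc M) (λ k → a * rhsSummand M k + b * (weight k * (d M (pred k) + d M (suc k))))
      ≈⟨ trans (∑₁-+ (suc M) _ _) (+-cong (∑₁-*ˡ (suc M) a _) (∑₁-*ˡ (suc M) b _)) ⟩
    a * ∑₁ (suc M) (rhsSummand M) + b * ∑₁ (suc M) (λ k → weight k * (d M (pred k) + d M (suc k)))
      ≈⟨ +-cong (*-congˡ (rhsPoly-extend M)) (*-congˡ (trans (d-neighbours M) (+-congʳ (d-zero M)))) ⟩
    a * rhsPoly M + b * (- Z + weight 2 * rhsPoly M)
      ≈⟨ solve 3 (λ Q W Z → let one = con (+ 1) ; G = one :- Q in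
           G :* (one :+ Q :* Q) :* W :+ :- (G :* Q) :* (:- Z :+ (one :+ (one :+ con (+ 0))) :* W)
             := G :* G :* G :* W :+ Q :* (G :* Z))
           refl Q (rhsPoly M) Z ⟩
    (1# - Q) ³ * rhsPoly M + Q * ((1# - Q) * Z)
      ≈⟨ +-congˡ (*-congˡ (poch-first Q M)) ⟨
    (1# - Q) ³ * rhsPoly M + Q * poch Q (suc M) ∎
    where
    Q a b Z : Carrier
    Q = q ^ suc M
    a = (1# - Q) * (1# + Q * Q)
    b = - ((1# - Q) * Q)
    Z = poch (q ^ (2 ℕ.+ M)) M
    summand-suc : ∀ j → j ≤ M →
      rhsSummand (suc M) (suc j) ≈ a * rhsSummand M (suc j) + b * (weight (suc j) * (d M j + d M (2 ℕ.+ j)))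
    summand-suc j j≤M = trans (*-congˡ (d-recurrence M j j≤M))
      (solve 5 (λ w Q d₁ d₀ d₂ → let one = con (+ 1) ; G = one :- Q in
         w :* (G :* ((one :+ Q :* Q) :* d₁ :- Q :* (d₀ :+ d₂)))
           := G :* (one :+ Q :* Q) :* (w :* d₁) :+ :- (G :* Q) :* (w :* (d₀ :+ d₂)))
         refl (weight (suc j)) Q (d M (suc j)) (d M j) (d M (2 ℕ.+ j)))

  lhsPoly≈rhsPoly : ∀ M → lhsPoly M ≈ rhsPoly M
  lhsPoly≈rhsPoly zero    = refl
  lhsPoly≈rhsPoly (suc M) = begin
    lhsPoly (suc M)                              ≈⟨ lhsPoly-suc M ⟩
    (1# - Q) ³ * lhsPoly M + Q * poch Q (suc M)  ≈⟨ +-congʳ (*-congˡ (lhsPoly≈rhsPoly M)) ⟩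
    (1# - Q) ³ * rhsPoly M + Q * poch Q (suc M)  ≈⟨ rhsPoly-suc M ⟨
    rhsPoly (suc M)                              ∎
    where
    Q : Carrier
    Q = q ^ suc M

infix 4 _≐_ _≈[_]_

_≐_ : FPS → FPS → Set
f ≐ g = ∀ n → f n ≡ g n

≐-refl : ∀ f → f ≐ f
≐-refl f n = ≡.refl

_≈[_]_ : FPS → ℕ → FPS → Set
f ≈[ N ] g = ∀ j → j ≤ N → f j ≡ g j

module _ where
  open ≡-Reasoning
  open import Algebra.Properties.CommutativeSemigroup ℤP.+-commutativeSemigroup using (interchange)

  sumTo-cong : ∀ n {f g : ℕ → ℤ} → (∀ k → k ≤ n → f k ≡ g k) → sumTo n f ≡ sumTo n g
  sumTo-cong zero    f≡g = f≡g 0 z≤n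
  sumTo-cong (suc n) f≡g =
    ≡.cong₂ ℤ._+_ (sumTo-cong n (λ k k≤n → f≡g k (ℕP.m≤n⇒m≤1+n k≤n))) (f≡g (suc n) ℕP.≤-refl)

  sumTo-+ : ∀ n (f g : ℕ → ℤ) → sumTo n (λ k → f k ℤ.+ g k) ≡ sumTo n f ℤ.+ sumTo n g
  sumTo-+ zero    f g = ≡.refl
  sumTo-+ (suc n) f g = ≡.trans (≡.cong (ℤ._+ (f (suc n) ℤ.+ g (suc n))) (sumTo-+ n f g))
                                (interchange (sumTo n f) (sumTo n g) (f (suc n)) (g (suc n)))

  sumTo-*ˡ : ∀ n c (f : ℕ → ℤ) → sumTo n (λ k → c ℤ.* f k) ≡ c ℤ.* sumTo n f
  sumTo-*ˡ zero    c f = ≡.refl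
  sumTo-*ˡ (suc n) c f = ≡.trans (≡.cong (ℤ._+ c ℤ.* f (suc n)) (sumTo-*ˡ n c f)) (≡.sym (ℤP.*-distribˡ-+ c _ _))

  sumTo-zero : ∀ n → sumTo n (λ _ → + 0) ≡ + 0
  sumTo-zero zero    = ≡.refl
  sumTo-zero (suc n) = ≡.cong (ℤ._+ + 0) (sumTo-zero n)

  sumTo-suc : ∀ n (f : ℕ → ℤ) → sumTo (suc n) f ≡ f 0 ℤ.+ sumTo n (λ k → f (suc k))
  sumTo-suc zero    f = ≡.refl
  sumTo-suc (suc n) f = ≡.trans (≡.cong (ℤ._+ f (2 ℕ.+ n)) (sumTo-suc n f)) (ℤP.+-assoc (f 0) _ _)

  sumTo-reverse : ∀ n (f : ℕ → ℤ) → sumTo n (λ k → f (n ∸ k)) ≡ sumTo n f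
  sumTo-reverse zero    f = ≡.refl
  sumTo-reverse (suc n) f = begin
    sumTo n (λ k → f (suc n ∸ k)) ℤ.+ f (n ∸ n)  ≡⟨ ≡.cong₂ ℤ._+_ (sumTo-cong n (λ k k≤n → ≡.cong f (ℕP.+-∸-assoc 1 k≤n)))
                                                                   (≡.cong f (ℕP.n∸n≡0 n)) ⟩
    sumTo n (λ k → f (suc (n ∸ k))) ℤ.+ f 0      ≡⟨ ≡.cong (ℤ._+ f 0) (sumTo-reverse n (λ k → f (suc k))) ⟩
    sumTo n (λ k → f (suc k)) ℤ.+ f 0            ≡⟨ ℤP.+-comm _ (f 0) ⟩
    f 0 ℤ.+ sumTo n (λ k → f (suc k))            ≡⟨ sumTo-suc n f ⟨
    sumTo (suc n) f                              ∎

  sum1To-cong : ∀ m {f g : ℕ → ℤ} → (∀ j → j < m → f (suc j) ≡ g (suc j)) → sum1To m f ≡ sum1To m g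
  sum1To-cong zero    f≡g = ≡.refl
  sum1To-cong (suc m) f≡g = ≡.cong₂ ℤ._+_ (sum1To-cong m (λ j j<m → f≡g j (ℕP.m<n⇒m<1+n j<m))) (f≡g m ℕP.≤-refl)

  tail : FPS → FPS
  tail f n = f (suc n)

  ⊛-suc : ∀ f g n → (f ⊛ g) (suc n) ≡ f 0 ℤ.* g (suc n) ℤ.+ (tail f ⊛ g) n
  ⊛-suc f g n = sumTo-suc n (λ k → f k ℤ.* g (suc n ∸ k))

  ⊛-cong : ∀ {f f′ g g′} → f ≐ f′ → g ≐ g′ → f ⊛ g ≐ f′ ⊛ g′
  ⊛-cong f≐f′ g≐g′ n = sumTo-cong n (λ k _ → ≡.cong₂ ℤ._*_ (f≐f′ k) (g≐g′ (n ∸ k)))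

  ⊛-comm : ∀ f g → f ⊛ g ≐ g ⊛ f
  ⊛-comm f g n = begin
    sumTo n (λ k → f k ℤ.* g (n ∸ k))              ≡⟨ sumTo-reverse n (λ k → f k ℤ.* g (n ∸ k)) ⟨
    sumTo n (λ k → f (n ∸ k) ℤ.* g (n ∸ (n ∸ k)))  ≡⟨ sumTo-cong n (λ k k≤n →
                                                        ≡.trans (≡.cong (λ i → f (n ∸ k) ℤ.* g i) (ℕP.m∸[m∸n]≡n k≤n))
                                                                (ℤP.*-comm (f (n ∸ k)) (g k))) ⟩
    sumTo n (λ k → g k ℤ.* f (n ∸ k))              ∎

  ⊛-distribˡ : ∀ f g h → f ⊛ (g ⊕ h) ≐ f ⊛ g ⊕ f ⊛ h
  ⊛-distribˡ f g h n = ≡.trans (sumTo-cong n (λ k _ → ℤP.*-distribˡ-+ (f k) (g (n ∸ k)) (h (n ∸ k)))) (sumTo-+ n _ _)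

  ⊛-distribʳ : ∀ f g h → (g ⊕ h) ⊛ f ≐ g ⊛ f ⊕ h ⊛ f
  ⊛-distribʳ f g h n = ≡.trans (sumTo-cong n (λ k _ → ℤP.*-distribʳ-+ (f (n ∸ k)) (g k) (h k))) (sumTo-+ n _ _)

  ⊛-scalarˡ : ∀ c f g → (c ·ₛ f) ⊛ g ≐ c ·ₛ (f ⊛ g)
  ⊛-scalarˡ c f g n = ≡.trans (sumTo-cong n (λ k _ → ℤP.*-assoc c (f k) (g (n ∸ k)))) (sumTo-*ˡ n c _)

  ⊛-assoc : ∀ f g h → (f ⊛ g) ⊛ h ≐ f ⊛ (g ⊛ h)
  ⊛-assoc f g h zero    = ℤP.*-assoc (f 0) (g 0) (h 0)
  ⊛-assoc f g h (suc n) = begin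
    ((f ⊛ g) ⊛ h) (suc n)
      ≡⟨ ⊛-suc (f ⊛ g) h n ⟩
    f₀ ℤ.* g₀ ℤ.* h₁ ℤ.+ (tail (f ⊛ g) ⊛ h) n
      ≡⟨ ≡.cong (λ x → f₀ ℤ.* g₀ ℤ.* h₁ ℤ.+ x)
                (≡.trans (⊛-cong (⊛-suc f g) (≐-refl h) n) (⊛-distribʳ h (f₀ ·ₛ tail g) (tail f ⊛ g) n)) ⟩
    f₀ ℤ.* g₀ ℤ.* h₁ ℤ.+ (((f₀ ·ₛ tail g) ⊛ h) n ℤ.+ ((tail f ⊛ g) ⊛ h) n)
      ≡⟨ ≡.cong₂ (λ x y → f₀ ℤ.* g₀ ℤ.* h₁ ℤ.+ (x ℤ.+ y)) (⊛-scalarˡ f₀ (tail g) h n) (⊛-assoc (tail f) g h n) ⟩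
    f₀ ℤ.* g₀ ℤ.* h₁ ℤ.+ (f₀ ℤ.* (tail g ⊛ h) n ℤ.+ (tail f ⊛ (g ⊛ h)) n)
      ≡⟨ regroup f₀ g₀ h₁ _ _ ⟩
    f₀ ℤ.* (g₀ ℤ.* h₁ ℤ.+ (tail g ⊛ h) n) ℤ.+ (tail f ⊛ (g ⊛ h)) n
      ≡⟨ ≡.cong (λ x → f₀ ℤ.* x ℤ.+ (tail f ⊛ (g ⊛ h)) n) (⊛-suc g h n) ⟨
    f₀ ℤ.* (g ⊛ h) (suc n) ℤ.+ (tail f ⊛ (g ⊛ h)) n
      ≡⟨ ⊛-suc f (g ⊛ h) n ⟨
    (f ⊛ (g ⊛ h)) (suc n) ∎
    where
    f₀ g₀ h₁ : ℤ
    f₀ = f 0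
    g₀ = g 0
    h₁ = h (suc n)
    regroup : ∀ a b c x y → a ℤ.* b ℤ.* c ℤ.+ (a ℤ.* x ℤ.+ y) ≡ a ℤ.* (b ℤ.* c ℤ.+ x) ℤ.+ y
    regroup = ℤ-Tactic.solve-∀

  ⊛-identityˡ : ∀ f → one ⊛ f ≐ f
  ⊛-identityˡ f zero    = ℤP.*-identityˡ (f 0)
  ⊛-identityˡ f (suc n) = begin
    (one ⊛ f) (suc n)                          ≡⟨ ⊛-suc one f n ⟩
    + 1 ℤ.* f (suc n) ℤ.+ sumTo n (λ _ → + 0)  ≡⟨ ≡.cong₂ ℤ._+_ (ℤP.*-identityˡ (f (suc n))) (sumTo-zero n) ⟩
    f (suc n) ℤ.+ + 0                          ≡⟨ ℤP.+-identityʳ (f (suc n)) ⟩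
    f (suc n)                                  ∎

  ⊛-identityʳ : ∀ f → f ⊛ one ≐ f
  ⊛-identityʳ f n = ≡.trans (⊛-comm f one n) (⊛-identityˡ f n)

FPS-commutativeRing : CommutativeRing _ _
FPS-commutativeRing = record
  { Carrier           = FPS
  ; _≈_               = _≐_
  ; _+_               = _⊕_
  ; _*_               = _⊛_
  ; -_                = λ f n → ℤ.- f n
  ; 0#                = λ _ → + 0
  ; 1#                = one
  ; isCommutativeRing = record
    { isRing = record
      { +-isAbelianGroup = Pointwise.isAbelianGroup ℕ ℤP.+-0-isAbelianGroup
      ; *-cong           = ⊛-cong
      ; *-assoc          = ⊛-assoc
      ; *-identity       = ⊛-identityˡ , ⊛-identityʳ
      ; distrib          = ⊛-distribˡ , ⊛-distribʳ
      }
    ; *-comm = ⊛-comm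
    }
  }

q : FPS
q = qpow 1

open FiniteIdentity FPS-commutativeRing q
open import Algebra.Properties.Semiring.Exp (CommutativeRing.semiring FPS-commutativeRing) using (_^_; ^-homo-*)

module _ where
  open ≡-Reasoning

  qpow-suc-⊛ : ∀ a f n → (qpow (suc a) ⊛ f) (suc n) ≡ (qpow a ⊛ f) n
  qpow-suc-⊛ a f n = ≡.trans (⊛-suc (qpow (suc a)) f n) (ℤP.+-identityˡ _)

  qpow-+ : ∀ a b → qpow a ⊛ qpow b ≐ qpow (a ℕ.+ b)
  qpow-+ zero    b n       = ⊛-identityˡ (qpow b) n
  qpow-+ (suc a) b zero    = ≡.refl
  qpow-+ (suc a) b (suc n) = ≡.trans (qpow-suc-⊛ a (qpow b) n) (qpow-+ a b n)

  qpow≐q^ : ∀ n → qpow n ≐ q ^ n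
  qpow≐q^ zero    i = ≡.refl
  qpow≐q^ (suc n) i = ≡.trans (≡.sym (qpow-+ 1 n i)) (⊛-cong (≐-refl q) (qpow≐q^ n) i)

  qPoch≐poch : ∀ a n → qPoch a n ≐ poch (q ^ a) n
  qPoch≐poch a zero    i = ≡.refl
  qPoch≐poch a (suc n) = ⊛-cong (qPoch≐poch a n)
    (λ i → ≡.cong (λ x → one i ℤ.- x) (≡.trans (qpow≐q^ (a ℕ.+ n) i) (^-homo-* q a n i)))

  ∑₁-coefficient : ∀ m f n → ∑₁ m f n ≡ sum1To m (λ k → f k n)
  ∑₁-coefficient zero    f n = ≡.refl
  ∑₁-coefficient (suc m) f n = ≡.cong (ℤ._+ f (suc m) n) (∑₁-coefficient m f n)

  ⊛-cong-≈[] : ∀ {N f f′ g g′} → f ≈[ N ] f′ → g ≈[ N ] g′ → f ⊛ g ≈[ N ] f′ ⊛ g′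
  ⊛-cong-≈[] f≈f′ g≈g′ j j≤N = sumTo-cong j (λ k k≤j →
    ≡.cong₂ ℤ._*_ (f≈f′ k (ℕP.≤-trans k≤j j≤N)) (g≈g′ (j ∸ k) (ℕP.≤-trans (ℕP.m∸n≤m j k) j≤N)))

  qpow-vanishes : ∀ e j → j < e → qpow e j ≡ + 0
  qpow-vanishes e j j<e with e ℕ.≡ᵇ j | ℕP.≡ᵇ⇒≡ e j
  ... | false | _   = ≡.refl
  ... | true  | e≡j = ⊥-elim (ℕP.<-irrefl (≡.sym (e≡j _)) j<e)

  1-qpow≈[]one : ∀ e N → N < e → one ⊖ₛ qpow e ≈[ N ] one
  1-qpow≈[]one e N N<e j j≤N =
    ≡.trans (≡.cong (λ x → one j ℤ.- x) (qpow-vanishes e j (ℕP.≤-<-trans j≤N N<e))) (ℤP.+-identityʳ (one j))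

  qPoch≈[]one : ∀ a n N → N < a → qPoch a n ≈[ N ] one
  qPoch≈[]one a zero    N N<a j j≤N = ≡.refl
  qPoch≈[]one a (suc n) N N<a j j≤N = ≡.trans
    (⊛-cong-≈[] (qPoch≈[]one a n N N<a) (1-qpow≈[]one (a ℕ.+ n) N (ℕP.<-≤-trans N<a (ℕP.m≤m+n a n))) j j≤N)
    (⊛-identityˡ one j)

  qPoch-extend : ∀ a m t N → N < a ℕ.+ m → qPoch a (m ℕ.+ t) ≈[ N ] qPoch a m
  qPoch-extend a m zero    N N< j j≤N = ≡.cong (λ m′ → qPoch a m′ j) (ℕP.+-identityʳ m)
  qPoch-extend a m (suc t) N N< j j≤N = begin
    qPoch a (m ℕ.+ suc t) j
      ≡⟨ ≡.cong (λ m′ → qPoch a m′ j) (ℕP.+-suc m t) ⟩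
    (qPoch a (m ℕ.+ t) ⊛ (one ⊖ₛ qpow (a ℕ.+ (m ℕ.+ t)))) j
      ≡⟨ ⊛-cong-≈[] (qPoch-extend a m t N N<)
                    (1-qpow≈[]one _ N (ℕP.<-≤-trans N< (ℕP.+-monoʳ-≤ a (ℕP.m≤m+n m t)))) j j≤N ⟩
    (qPoch a m ⊛ one) j
      ≡⟨ ⊛-identityʳ (qPoch a m) j ⟩
    qPoch a m j ∎

  qPochInf≈[] : ∀ n N → n ≤ N → qPochInf (suc n) ≈[ N ] qPoch (suc n) (N ∸ n)
  qPochInf≈[] n N n≤N j j≤N = begin
    qPoch (suc n) (suc j) j              ≡⟨ qPoch-extend (suc n) (suc j) (N ∸ n) j j<1+n+1+j j ℕP.≤-refl ⟨
    qPoch (suc n) (suc j ℕ.+ (N ∸ n)) j  ≡⟨ ≡.cong (λ m → qPoch (suc n) m j) (ℕP.+-comm (suc j) (N ∸ n)) ⟩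
    qPoch (suc n) ((N ∸ n) ℕ.+ suc j) j  ≡⟨ qPoch-extend (suc n) (N ∸ n) (suc j) j j<1+N j ℕP.≤-refl ⟩
    qPoch (suc n) (N ∸ n) j              ∎
    where
    j<1+n+1+j : j < suc n ℕ.+ suc j
    j<1+n+1+j = ℕP.m≤n⇒m≤1+n (ℕP.m≤n+m (suc j) n)
    j<1+N : j < suc n ℕ.+ (N ∸ n)
    j<1+N = s≤s (≡.subst (j ≤_) (≡.sym (ℕP.m+[n∸m]≡n n≤N)) j≤N)

  qpow-⊛-≈[] : ∀ T m {f g} → f ≈[ m ] g → qpow T ⊛ f ≈[ T ℕ.+ m ] qpow T ⊛ g
  qpow-⊛-≈[] zero    m {f} {g} f≈g j       j≤m     =
    ≡.trans (⊛-identityˡ f j) (≡.trans (f≈g j j≤m) (≡.sym (⊛-identityˡ g j)))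
  qpow-⊛-≈[] (suc T) m         f≈g zero    _       = ≡.refl
  qpow-⊛-≈[] (suc T) m {f} {g} f≈g (suc j) (s≤s j≤) =
    ≡.trans (qpow-suc-⊛ T f j) (≡.trans (qpow-⊛-≈[] T m f≈g j j≤) (≡.sym (qpow-suc-⊛ T g j)))

  P≈[]one : ∀ N k → k ≤ N → P N k ≈[ N ∸ k ] one
  P≈[]one N k k≤N j j≤ = begin
    P N k j
      ≡⟨ ⊛-cong (qPoch≐poch (suc N ∸ k) k) (qPoch≐poch (2 ℕ.+ N ℕ.+ k) (N ∸ k)) j ⟨
    (qPoch (suc N ∸ k) k ⊛ qPoch (2 ℕ.+ N ℕ.+ k) (N ∸ k)) j
      ≡⟨ ⊛-cong-≈[] (qPoch≈[]one _ k (N ∸ k) lt₁) (qPoch≈[]one _ (N ∸ k) (N ∸ k) lt₂) j j≤ ⟩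
    (one ⊛ one) j
      ≡⟨ ⊛-identityˡ one j ⟩
    one j ∎
    where
    lt₁ : N ∸ k < suc N ∸ k
    lt₁ = ≡.subst (N ∸ k <_) (≡.sym (ℕP.+-∸-assoc 1 k≤N)) ℕP.≤-refl
    lt₂ : N ∸ k < 2 ℕ.+ N ℕ.+ k
    lt₂ = s≤s (ℕP.m≤n⇒m≤1+n (ℕP.≤-trans (ℕP.m∸n≤m N k) (ℕP.m≤m+n N k)))

  weight-⊛ : ∀ k f n → (weight k ⊛ f) n ≡ + k ℤ.* f n
  weight-⊛ zero    f n = sumTo-zero n
  weight-⊛ (suc k) f n = begin
    ((one ⊕ weight k) ⊛ f) n          ≡⟨ ⊛-distribʳ f one (weight k) n ⟩
    (one ⊛ f) n ℤ.+ (weight k ⊛ f) n  ≡⟨ ≡.cong₂ ℤ._+_ (⊛-identityˡ f n) (weight-⊛ k f n) ⟩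
    f n ℤ.+ + k ℤ.* f n               ≡⟨ ℤP.suc-* (+ k) (f n) ⟨
    + suc k ℤ.* f n                   ∎

  neg-⊛ : ∀ g f n → ((λ i → ℤ.- g i) ⊛ f) n ≡ ℤ.- (g ⊛ f) n
  neg-⊛ g f n = begin
    ((λ i → ℤ.- g i) ⊛ f) n  ≡⟨ ⊛-cong (λ i → ≡.sym (ℤP.-1*i≡-i (g i))) (≐-refl f) n ⟩
    ((-1ℤ ·ₛ g) ⊛ f) n       ≡⟨ ⊛-scalarˡ -1ℤ g f n ⟩
    -1ℤ ℤ.* (g ⊛ f) n        ≡⟨ ℤP.-1*i≡-i _ ⟩
    ℤ.- (g ⊛ f) n            ∎

  sign-⊛ : ∀ k f n → (sign k ⊛ f) n ≡ -1ℤ ℤ.^ suc k ℤ.* f n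
  sign-⊛ zero    f n =
    ≡.trans (neg-⊛ one f n) (≡.trans (≡.cong ℤ.-_ (⊛-identityˡ f n)) (≡.sym (ℤP.-1*i≡-i (f n))))
  sign-⊛ (suc k) f n = begin
    ((λ i → ℤ.- sign k i) ⊛ f) n  ≡⟨ neg-⊛ (sign k) f n ⟩
    ℤ.- (sign k ⊛ f) n            ≡⟨ ≡.cong ℤ.-_ (sign-⊛ k f n) ⟩
    ℤ.- (s ℤ.* f n)               ≡⟨ ℤP.neg-distribˡ-* s (f n) ⟩
    ℤ.- s ℤ.* f n                 ≡⟨ ≡.cong (ℤ._* f n) (ℤP.-1*i≡-i s) ⟨
    -1ℤ ℤ.* s ℤ.* f n             ∎
    where
    s : ℤ
    s = -1ℤ ℤ.^ suc k

  lhsTerm-coefficient : ∀ n N → n ≤ N → lhsTerm n N ≡ lhsSummand N n N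
  lhsTerm-coefficient n N n≤N = begin
    (qpow n ⊛ cube (qPochInf (suc n)) ⊛ qPoch n n) N
      ≡⟨ ⊛-cong-≈[] (⊛-cong-≈[] (≈[]-refl (qpow n)) (cube-≈[] (qPochInf≈[] n N n≤N))) (≈[]-refl (qPoch n n))
                    N ℕP.≤-refl ⟩
    (qpow n ⊛ cube (qPoch (suc n) (N ∸ n)) ⊛ qPoch n n) N
      ≡⟨ ⊛-cong (⊛-cong (qpow≐q^ n) (cube-≐ (qPoch≐poch (suc n) (N ∸ n)))) (qPoch≐poch n n) N ⟩
    lhsSummand N n N ∎
    where
    ≈[]-refl : ∀ f → f ≈[ N ] f
    ≈[]-refl f _ _ = ≡.refl
    cube-≈[] : ∀ {f g} → f ≈[ N ] g → cube f ≈[ N ] cube g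
    cube-≈[] f≈g = ⊛-cong-≈[] (⊛-cong-≈[] f≈g f≈g) f≈g
    cube-≐ : ∀ {f g} → f ≐ g → cube f ≐ cube g
    cube-≐ f≐g = ⊛-cong (⊛-cong f≐g f≐g) f≐g

  rhsSummand-coefficient : ∀ k N → k ≤ N → rhsSummand N k N ≡ rhsTerm k N
  rhsSummand-coefficient k N k≤N = begin
    rhsSummand N k N                          ≡⟨ weight-⊛ k (d N k) N ⟩
    + k ℤ.* (sign k ⊛ (q ^ tri k ⊛ P N k)) N  ≡⟨ ≡.cong (+ k ℤ.*_) (sign-⊛ k (q ^ tri k ⊛ P N k) N) ⟩
    + k ℤ.* (s ℤ.* (q ^ tri k ⊛ P N k) N)     ≡⟨ ≡.cong (λ x → + k ℤ.* (s ℤ.* x)) leading ⟩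
    + k ℤ.* (s ℤ.* qpow (tri k) N)            ≡⟨ rearrange (+ k) s (qpow (tri k) N) ⟩
    s ℤ.* + k ℤ.* qpow (tri k) N              ≡⟨ ≡.cong (λ e → s ℤ.* + k ℤ.* qpow e N) (tri-div k) ⟨
    rhsTerm k N                               ∎
    where
    s : ℤ
    s = -1ℤ ℤ.^ suc k
    N≤ : N ≤ tri k ℕ.+ (N ∸ k)
    N≤ = ≡.subst (ℕ._≤ tri k ℕ.+ (N ∸ k)) (ℕP.m+[n∸m]≡n k≤N) (ℕP.+-monoˡ-≤ (N ∸ k) (tri≥ k))
    leading : (q ^ tri k ⊛ P N k) N ≡ qpow (tri k) N
    leading = begin
      (q ^ tri k ⊛ P N k) N     ≡⟨ ⊛-cong (qpow≐q^ (tri k)) (≐-refl (P N k)) N ⟨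
      (qpow (tri k) ⊛ P N k) N  ≡⟨ qpow-⊛-≈[] (tri k) (N ∸ k) (P≈[]one N k k≤N) N N≤ ⟩
      (qpow (tri k) ⊛ one) N    ≡⟨ ⊛-identityʳ (qpow (tri k)) N ⟩
      qpow (tri k) N            ∎
    rearrange : ∀ a b c → a ℤ.* (b ℤ.* c) ≡ b ℤ.* a ℤ.* c
    rearrange = ℤ-Tactic.solve-∀

theorem1p2 : (N : ℕ) → infSum1 lhsTerm N ≡ infSum1 rhsTerm N
theorem1p2 N = begin
  sum1To N (λ n → lhsTerm n N)       ≡⟨ sum1To-cong N (λ j j<N → lhsTerm-coefficient (suc j) N j<N) ⟩
  sum1To N (λ n → lhsSummand N n N)  ≡⟨ ∑₁-coefficient N (lhsSummand N) N ⟨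
  lhsPoly N N                        ≡⟨ lhsPoly≈rhsPoly N N ⟩
  rhsPoly N N                        ≡⟨ ∑₁-coefficient N (rhsSummand N) N ⟩
  sum1To N (λ k → rhsSummand N k N)  ≡⟨ sum1To-cong N (λ j j<N → rhsSummand-coefficient (suc j) N j<N) ⟩
  sum1To N (λ k → rhsTerm k N)       ∎
  where open ≡-Reasoning
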